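{- If an $r$-graph $H$ is $2$-locally large, then $H$ has at least three edges.
   Context: An $r$-graph is an $r$-uniform hypergraph. Let $H$ be an $r$-graph on $h$ vertices and $\sigma:V(H)\to[h]$ a bijection. For a vertex $x$ and $1\le i\le r$, let $T_x^i$ be the set of edges $e\ni x$ such that $x$ is the $i$-th element of $e$ when the vertices of $e$ are listed in increasing order of $\sigma$; for $r+1\le i\le 2r+1$, let $T_x^i$ be the set of edges $e\not\ni x$ such that $x$ is the $(i-r)$-th element of $e\cup\{x\}$ when listed in increasing order of $\sigma$. $H$ is 2-locally large if there is a bijection $\sigma$ such that for every vertex $x\in V(H)$ some $T_x^i$, $i\in[2r+1]$, contains at least two edges. -}

module Defs where

open import Data.Nat using (ℕ; suc; _+_; _*_; _≤_)
open import Data.Fin using (Fin; _<?_)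
open import Data.Fin.Subset using (Subset; _∈_; _∉_; _∩_; ∣_∣)
open import Data.Fin.Permutation using (Permutation′; _⟨$⟩ʳ_)
open import Data.Vec using (tabulate)
open import Data.Product using (Σ; ∃; _×_)
open import Data.Sum using (_⊎_)
open import Relation.Nullary using (¬_; does)
open import Relation.Binary.PropositionalEquality using (_≡_; _≢_)

record RGraph (r h : ℕ) : Set₁ where
  field
    Edge    : Subset h → Set
    uniform : ∀ e → Edge e → ∣ e ∣ ≡ r
open RGraph public

below : ∀ {h} → Permutation′ h → Fin h → Subset h
below σ x = tabulate (λ y → does ((σ ⟨$⟩ʳ y) <? (σ ⟨$⟩ʳ x)))

-- position (1-based) of x in e ∪ {x}, listed in increasing σ-order
pos : ∀ {h} → Permutation′ h → Fin h → Subset h → ℕ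
pos σ x e = suc ∣ e ∩ below σ x ∣

InT : ∀ {h} (r : ℕ) → Permutation′ h → Fin h → ℕ → Subset h → Set
InT r σ x i e =
    (1 ≤ i × i ≤ r × x ∈ e × pos σ x e ≡ i)
  ⊎ (suc r ≤ i × i ≤ 2 * r + 1 × x ∉ e × pos σ x e + r ≡ i)

AtLeastTwo : ∀ {h} → (Subset h → Set) → Set
AtLeastTwo P = Σ _ λ e₁ → Σ _ λ e₂ → e₁ ≢ e₂ × P e₁ × P e₂

AtLeastThree : ∀ {h} → (Subset h → Set) → Set
AtLeastThree P = Σ _ λ e₁ → Σ _ λ e₂ → Σ _ λ e₃ →
  e₁ ≢ e₂ × e₁ ≢ e₃ × e₂ ≢ e₃ × P e₁ × P e₂ × P e₃

TwoLocallyLarge : ∀ {r h} → RGraph r h → Set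
TwoLocallyLarge {r} {h} H =
  Σ (Permutation′ h) λ σ → ∀ (x : Fin h) →
    ∃ λ i → AtLeastTwo (λ e → Edge H e × InT r σ x i e)

{-# OPTIONS --safe #-}
module Submission where

-- Take any vertex x: some T_x^i contains two distinct edges a and b, which differ
-- at some vertex y. Some T_y^j contains two distinct edges c and d, and since the
-- index j alone decides whether y lies in a member of T_y^j, c and d agree at y.
-- Hence {c, d} ≠ {a, b}, and one of c, d is a third edge.

open import Defs
open import Data.Nat using (ℕ; _≤_; suc)
open import Data.Nat.Properties using (<⇒≱)
open import Data.Bool.Properties using () renaming (_≟_ to _≟ᴮ_)
open import Data.Fin using (Fin; zero)
open import Data.Fin.Properties using (¬∀⟶∃¬)
open import Data.Fin.Permutation using (Permutation′)
open import Data.Fin.Subset using (Subset; _∈_)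
open import Data.Fin.Subset.Properties using (_∈?_; ⊆-antisym)
open import Data.Vec.Properties using (≡-dec)
open import Data.Product using (∃; _×_; _,_; uncurry)
open import Data.Sum using (_⊎_; inj₁; inj₂)
open import Data.Empty using (⊥-elim)
open import Function using (_∘_; const)
open import Function.Bundles using (_⇔_; mk⇔; Equivalence)
import Function.Properties.Equivalence as ⇔
open import Relation.Nullary using (¬_; Dec; yes; no)
open import Relation.Nullary.Decidable using (map′; _×-dec_; _→-dec_)
open import Relation.Binary.Definitions using (DecidableEquality)
open import Relation.Binary.PropositionalEquality using (_≢_; refl)

open Equivalence using (to; from)

_⇔-dec_ : ∀ {a b} {A : Set a} {B : Set b} → Dec A → Dec B → Dec (A ⇔ B)
a? ⇔-dec b? = map′ (uncurry mk⇔) (λ a⇔b → to a⇔b , from a⇔b) ((a? →-dec b?) ×-dec (b? →-dec a?))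

_≟ˢ_ : ∀ {n} → DecidableEquality (Subset n)
_≟ˢ_ = ≡-dec _≟ᴮ_

AgreeAt : ∀ {n} → Fin n → Subset n → Subset n → Set
AgreeAt y p q = y ∈ p ⇔ y ∈ q

separating-vertex : ∀ {n} {p q : Subset n} → p ≢ q → ∃ λ y → ¬ AgreeAt y p q
separating-vertex {n} {p} {q} p≢q =
  ¬∀⟶∃¬ n _ (λ y → (y ∈? p) ⇔-dec (y ∈? q))
    (λ agree → p≢q (⊆-antisym (to (agree _)) (from (agree _))))

InT⇒∈⇔≤ : ∀ {r h} (σ : Permutation′ h) {x : Fin h} {i e} → InT r σ x i e → (x ∈ e ⇔ i ≤ r)
InT⇒∈⇔≤ _ (inj₁ (_ , i≤r , x∈e , _)) = mk⇔ (const i≤r) (const x∈e)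
InT⇒∈⇔≤ _ (inj₂ (r<i , _ , x∉e , _)) = mk⇔ (⊥-elim ∘ x∉e) (⊥-elim ∘ <⇒≱ r<i)

InT⇒AgreeAt : ∀ {r h} (σ : Permutation′ h) {x : Fin h} {i c d} →
  InT r σ x i c → InT r σ x i d → AgreeAt x c d
InT⇒AgreeAt σ Tc Td = ⇔.trans (InT⇒∈⇔≤ σ Tc) (⇔.sym (InT⇒∈⇔≤ σ Td))

avoids-pair : ∀ {a ℓ ℓ′} {A : Set a} → DecidableEquality A →
  (R : A → A → Set ℓ) (P : A → Set ℓ′) →
  ∀ {p q c d} → ¬ R p q → ¬ R q p → R c d → c ≢ d → P c → P d →
  ∃ λ e → P e × p ≢ e × q ≢ e
avoids-pair _≟_ R P {p} {q} {c} ¬Rpq ¬Rqp Rcd c≢d Pc Pd with p ≟ c | q ≟ c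
... | yes refl | _        = _ , Pd , (λ { refl → c≢d refl }) , (λ { refl → ¬Rpq Rcd })
... | no _     | yes refl = _ , Pd , (λ { refl → ¬Rqp Rcd }) , (λ { refl → c≢d refl })
... | no p≢c   | no q≢c   = c , Pc , p≢c , q≢c

proposition2p5 : ∀ (r h : ℕ) → 1 ≤ h → (H : RGraph r h) →
    TwoLocallyLarge H → AtLeastThree (Edge H)
proposition2p5 r (suc h) _ H (σ , large) =
  let (_ , a , b , a≢b , (Ea , _) , (Eb , _)) = large zero
      (y , a≁b) = separating-vertex a≢b
      (_ , c , d , c≢d , (Ec , Tc) , (Ed , Td)) = large y
      (e , Ee , a≢e , b≢e) = avoids-pair _≟ˢ_ (AgreeAt y) (Edge H) a≁b (a≁b ∘ ⇔.sym)
                               (InT⇒AgreeAt σ Tc Td) c≢d Ec Ed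
  in a , b , e , a≢b , a≢e , b≢e , Ea , Eb , Ee
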